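{- Let $E$ be a finite set and $\mathcal{D}\subseteq2^E$ an accessible distributive lattice. The base polyhedra of U-matroids of the form $(E,\mathcal{D},\rho)$ are precisely the Minkowski sums $\mathcal{B}(M)+\operatorname{rec}(\mathcal{D})$, where $M$ ranges over matroids on $E$.
   Context: An accessible distributive lattice $\mathcal{D}\subseteq2^E$ contains $\emptyset,E$, is closed under union and intersection, and every nonempty $A\in\mathcal{D}$ contains some $x$ with $A\setminus\{x\}\in\mathcal{D}$. A U-matroid is a triple $(E,\mathcal{D},\rho)$ with $\rho:\mathcal{D}\to\mathbb{N}$ satisfying $\rho(\emptyset)=0$, monotonicity, submodularity, and unit increase ($\rho(A\cup\{e\})-\rho(A)\le1$ whenever $A,A\cup\{e\}\in\mathcal{D}$); a matroid is the case $\mathcal{D}=2^E$. Base polyhedron: $\mathcal{B}(U)=\{\mathbf{x}\in\mathbb{R}^E:\sum_{a\in A}x_a\le\rho(A)\ \forall A\in\mathcal{D},\ \sum_{e\in E}x_e=\rho(E)\}$ (for a matroid this is its base polytope). With $P$ the poset on $E$ where $i\le_P j$ iff every element of $\mathcal{D}$ containing $j$ contains $i$, $\operatorname{rec}(\mathcal{D})=\mathbb{R}_{\ge0}\langle\mathbf{e}_j-\mathbf{e}_i:j>_P i\rangle$.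
   Formalization: The base polyhedra, rec(𝒟) and the Minkowski sums $\mathcal{B}(M)+\operatorname{rec}(\mathcal{D})$ are taken in ℚ^E instead of ℝ^E, with rational nonnegative coefficients for the generators of rec(𝒟). -}

module Defs where

open import Data.Nat using (ℕ; zero; suc)
import Data.Nat as ℕ
open import Data.Bool using (Bool; true; false; if_then_else_)
open import Data.Integer using (+_)
open import Data.Rational using (ℚ; 0ℚ; _+_; _-_; _≤_; _/_)
open import Data.Fin using (Fin)
open import Data.Fin.Subset using (Subset; _∈_; _∉_; _⊆_; _∪_; _∩_; ⁅_⁆; outside)
import Data.Fin.Subset as Sub
open import Data.Vec using (lookup; _[_]≔_)
open import Data.Product using (Σ; _×_; ∃; ∃-syntax)
open import Relation.Binary.PropositionalEquality using (_≡_; _≢_)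

-- Ground set E = Fin n.  A family 𝒟 ⊆ 2^E is given by its characteristic
-- function 𝒟 : Subset n → Bool.
Family : ℕ → Set
Family n = Subset n → Bool

_∈𝒟_ : ∀ {n} → Subset n → Family n → Set
A ∈𝒟 𝒟 = 𝒟 A ≡ true

_∖⁅_⁆ : ∀ {n} → Subset n → Fin n → Subset n
A ∖⁅ x ⁆ = A [ x ]≔ outside

record AccessibleDistributiveLattice {n : ℕ} (𝒟 : Family n) : Set where
  field
    has-∅     : Sub.⊥ ∈𝒟 𝒟
    has-E     : Sub.⊤ ∈𝒟 𝒟
    ∪-closed  : ∀ A B → A ∈𝒟 𝒟 → B ∈𝒟 𝒟 → (A ∪ B) ∈𝒟 𝒟
    ∩-closed  : ∀ A B → A ∈𝒟 𝒟 → B ∈𝒟 𝒟 → (A ∩ B) ∈𝒟 𝒟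
    accessible : ∀ A → A ∈𝒟 𝒟 → A ≢ Sub.⊥ →
                 ∃[ x ] (x ∈ A × (A ∖⁅ x ⁆) ∈𝒟 𝒟)

-- ρ is given as a total function Subset n → ℕ; only its values on 𝒟 matter
-- (all axioms and the base polyhedron only refer to sets in 𝒟).
record IsUMatroid {n : ℕ} (𝒟 : Family n) (ρ : Subset n → ℕ) : Set where
  field
    ρ-∅        : ρ Sub.⊥ ≡ 0
    monotone   : ∀ A B → A ∈𝒟 𝒟 → B ∈𝒟 𝒟 → A ⊆ B → ρ A ℕ.≤ ρ B
    submodular : ∀ A B → A ∈𝒟 𝒟 → B ∈𝒟 𝒟 →
                 ρ (A ∪ B) ℕ.+ ρ (A ∩ B) ℕ.≤ ρ A ℕ.+ ρ B
    unit-increase : ∀ A e → A ∈𝒟 𝒟 → (A ∪ ⁅ e ⁆) ∈𝒟 𝒟 →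
                    ρ (A ∪ ⁅ e ⁆) ℕ.≤ suc (ρ A)

allSubsets : ∀ {n} → Family n
allSubsets _ = true

IsMatroid : ∀ {n} → (Subset n → ℕ) → Set
IsMatroid ρ = IsUMatroid allSubsets ρ

Pt : ℕ → Set
Pt n = Fin n → ℚ

sumℚ : ∀ {n} → (Fin n → ℚ) → ℚ
sumℚ {zero}  f = 0ℚ
sumℚ {suc n} f = f Fin.zero + sumℚ (λ i → f (Fin.suc i))
  where import Data.Fin as Fin

sumOver : ∀ {n} → Subset n → Pt n → ℚ
sumOver A x = sumℚ (λ a → if lookup A a then x a else 0ℚ)

ℕtoℚ : ℕ → ℚ
ℕtoℚ k = (+ k) / 1

InBase : ∀ {n} → Family n → (Subset n → ℕ) → Pt n → Set
InBase {n} 𝒟 ρ x =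
  (∀ A → A ∈𝒟 𝒟 → sumOver A x ≤ ℕtoℚ (ρ A)) ×
  (sumOver Sub.⊤ x ≡ ℕtoℚ (ρ Sub.⊤))

_≤[_]_ : ∀ {n} → Fin n → Family n → Fin n → Set
i ≤[ 𝒟 ] j = ∀ A → A ∈𝒟 𝒟 → j ∈ A → i ∈ A

_>[_]_ : ∀ {n} → Fin n → Family n → Fin n → Set
j >[ 𝒟 ] i = (i ≤[ 𝒟 ] j) × (i ≢ j)

-- v ∈ rec(𝒟) = ℝ_{≥0}⟨ e_j - e_i : j >_P i ⟩ (over ℚ): v = Σ_{i,j} λ i j (e_j - e_i)
-- with λ ≥ 0 and λ i j = 0 unless j >_P i.
InRec : ∀ {n} → Family n → Pt n → Set
InRec {n} 𝒟 v = Σ (Fin n → Fin n → ℚ) λ λ' →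
  (∀ i j → 0ℚ ≤ λ' i j) ×
  (∀ i j → λ' i j ≢ 0ℚ → j >[ 𝒟 ] i) ×
  (∀ k → v k ≡ sumℚ (λ i → λ' i k) - sumℚ (λ j → λ' k j))

InBasePlusRec : ∀ {n} → Family n → (Subset n → ℕ) → Pt n → Set
InBasePlusRec {n} 𝒟 r x = Σ (Pt n) λ y → Σ (Pt n) λ v →
  InBase allSubsets r y × InRec 𝒟 v × (∀ k → x k ≡ y k + v k)

_≐_ : ∀ {n} → (Pt n → Set) → (Pt n → Set) → Set
_≐_ {n} P Q = ∀ (x : Pt n) → (P x → Q x) × (Q x → P x)

-- Both directions reduce to one fact about a submodular r : 2^E → ℕ: the polyhedron
-- {x : x(A) ≤ r(A) for A ∈ 𝒟, x(E) = r(E)} equals B(r) + rec(𝒟). A matroid rank restricts to a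
-- U-matroid on 𝒟 with the same constraints; conversely a U-matroid ρ extends to the matroid rank
-- r(X) = min_{B ∈ 𝒟} ρ(B) + |X ∖ B|, which agrees with ρ on 𝒟 because accessibility and unit
-- increase give ρ(B ∪ A) ≤ ρ(B) + |A ∖ B| for A, B ∈ 𝒟.
--
-- For the polyhedral fact, ⊇ holds because each e_j − e_i with j >_P i has nonpositive sum over
-- every A ∈ 𝒟. For ⊆, the members of 𝒟 are exactly the sets closed under all arcs i <_P j, since
-- A = ⋃_{j ∈ A} downset j. Treat the arcs one at a time: for the arc (i , j), shift
-- ε = max(0, max x(A) − r(A)) from j to i, the inner max ranging over the sets closed under the
-- remaining arcs that contain j but not i. This repairs exactly those sets, and a set A that
-- contains i but not j can afford the gain ε by submodularity applied to A and a maximiser.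
-- Once no arcs remain every set is constrained, so the shifted point lies in B(r), and the
-- shifts add up to a point of rec(𝒟).

module Submission where

open import Defs
open import Data.Nat using (ℕ)
open import Data.Fin.Subset using (Subset)
open import Data.Product using (Σ; _×_)

import Data.Nat.Properties as ℕP
import Data.Rational.Properties as ℚP
open import Relation.Binary.Bundles using (DecTotalOrder)

open import Algebra.Bundles using (CommutativeMonoid)
open import Algebra.Properties.CommutativeMonoid.Sum ℚP.+-0-commutativeMonoid
  using (sum; sum-cong-≗; ∑-distrib-+; ∑-comm; sum-replicate-zero)
import Algebra.Properties.CommutativeSemigroup as CommutativeSemigroupProperties
open import Data.Bool using (Bool; true; false; if_then_else_; _∨_; _∧_)
import Data.Bool as Bool
open import Data.Fin using (Fin; zero; suc; _≟_)
open import Data.Fin.Subset using (_∈_; _∉_; _⊆_; _∪_; _∩_; _─_; ⁅_⁆; ⋃; ⋂; ∣_∣)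
import Data.Fin.Subset as Sub
open import Data.Fin.Subset.Properties
  using (_∈?_; ∈⊤; ∉⊥; ⊆-antisym; q⊆p∪q; x∈p∪q⁺; x∈p∪q⁻; x∈p∩q⁺; x∈p∩q⁻; ∪-identityʳ;
         x∈⁅x⁆; x∈⁅y⁆⇒x≡y; p─⊥≡p; p─q⊆p; p─q─r≡p─r─q; x∈p∧x∉q⇒x∈p─q; x∈p∧x≢y⇒x∈p-y;
         p⊆q⇒∣p∣≤∣q∣; ∣⊥∣≡0; ∣⁅x⁆∣≡1; x∈p⇒∣p-x∣<∣p∣)
open import Data.Integer using (1ℤ)
import Data.Integer as ℤ
import Data.Integer.Properties as ℤP
open import Data.Integer.Solver using () renaming (module +-*-Solver to ℤSolver)
open import Data.List using (List; []; _∷_; [_]; _++_; map; filter; allFin; cartesianProduct)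
open import Data.List.Extrema (DecTotalOrder.totalOrder ℚP.≤-decTotalOrder)
  using (max; xs≤max; v≤max⁺; argmax-sel)
open import Data.List.Extrema ℕP.≤-totalOrder using (argmin; f[argmin]≤v⁺; argmin-all)
open import Data.List.Membership.Propositional using (find; lose) renaming (_∈_ to _∈ₗ_)
open import Data.List.Membership.Propositional.Properties
  using (∈-++⁺ˡ; ∈-++⁺ʳ; ∈-map⁺; ∈-filter⁺; ∈-map∘filter⁺; ∈-map∘filter⁻;
         ∈-allFin; ∈-cartesianProduct⁺)
open import Data.List.Relation.Unary.All as All using (All; []; _∷_; all?)
import Data.List.Relation.Unary.All.Properties as All
open import Data.List.Relation.Unary.All.Properties using (all-filter)
open import Data.List.Relation.Unary.Any using (Any; here; there)
open import Data.Nat using (zero; suc)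
import Data.Nat as ℕ
open import Data.Nat.Induction using (<-wellFounded)
open import Data.Product using (_,_; proj₁; proj₂; ∃)
import Data.Product as Product
open import Data.Rational using (ℚ; 0ℚ; _+_; _-_; -_; _≤_; toℚᵘ)
open import Data.Rational.Solver using (module +-*-Solver)
open import Data.Rational.Unnormalised using (mkℚᵘ; *≡*; *≤*) renaming (_≃_ to _≃ᵘ_)
import Data.Rational.Unnormalised as ℚᵘ
import Data.Rational.Unnormalised.Properties as ℚᵘP
open import Data.Sum using (_⊎_; inj₁; inj₂)
import Data.Sum as Sum
open import Data.Vec using ([]; _∷_; lookup; here; there)
open import Data.Vec.Properties using ([]=⇒lookup; lookup⇒[]=; lookup-replicate; ≡-dec)
open import Function using (_∘_; id; case_of_)
open import Induction.WellFounded using (Acc; acc)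
open import Relation.Binary.PropositionalEquality
  using (_≡_; _≢_; refl; sym; trans; cong; cong₂; subst; subst₂; _≗_; module ≡-Reasoning)
open import Relation.Nullary using (Dec; yes; no; does; ¬?; contradiction)
open import Relation.Nullary.Decidable using (_×-dec_; _→-dec_)
open import Relation.Unary using (Decidable)

open +-*-Solver using (solve; _:+_; _:-_; :-_; _:=_; con)
module ℚ+ = CommutativeSemigroupProperties
  (CommutativeMonoid.commutativeSemigroup ℚP.+-0-commutativeMonoid)
module ℕ+ = CommutativeSemigroupProperties ℕP.+-commutativeSemigroup

sumℚ≡sum : ∀ {n} (f : Fin n → ℚ) → sumℚ f ≡ sum f
sumℚ≡sum {zero}  f = refl
sumℚ≡sum {suc n} f = cong (f zero +_) (sumℚ≡sum (f ∘ suc))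

sumℚ-cong : ∀ {n} {f g : Fin n → ℚ} → f ≗ g → sumℚ f ≡ sumℚ g
sumℚ-cong {f = f} {g} f≗g =
  trans (sumℚ≡sum f) (trans (sum-cong-≗ f≗g) (sym (sumℚ≡sum g)))

sumℚ-zero : ∀ n → sumℚ {n} (λ _ → 0ℚ) ≡ 0ℚ
sumℚ-zero n = trans (sumℚ≡sum {n} _) (sum-replicate-zero n)

sumℚ-+ : ∀ {n} (f g : Fin n → ℚ) → sumℚ (λ i → f i + g i) ≡ sumℚ f + sumℚ g
sumℚ-+ f g = trans (sumℚ≡sum (λ i → f i + g i))
  (trans (∑-distrib-+ f g) (sym (cong₂ _+_ (sumℚ≡sum f) (sumℚ≡sum g))))

sumℚ-neg : ∀ {n} (f : Fin n → ℚ) → sumℚ (λ i → - f i) ≡ - sumℚ f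
sumℚ-neg {zero}  f = refl
sumℚ-neg {suc n} f = trans (cong (- f zero +_) (sumℚ-neg (f ∘ suc)))
  (sym (ℚP.neg-distrib-+ (f zero) _))

sumℚ-- : ∀ {n} (f g : Fin n → ℚ) → sumℚ (λ i → f i - g i) ≡ sumℚ f - sumℚ g
sumℚ-- f g = trans (sumℚ-+ f (λ i → - g i)) (cong (sumℚ f +_) (sumℚ-neg g))

sumℚ-comm : ∀ {m n} (h : Fin m → Fin n → ℚ) →
  sumℚ (λ i → sumℚ (h i)) ≡ sumℚ (λ j → sumℚ (λ i → h i j))
sumℚ-comm {m} {n} h = begin
  sumℚ (λ i → sumℚ (h i))               ≡⟨ sumℚ-cong (λ i → sumℚ≡sum (h i)) ⟩
  sumℚ (λ i → sum (h i))                ≡⟨ sumℚ≡sum {m} _ ⟩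
  sum (λ i → sum (h i))                 ≡⟨ ∑-comm h ⟩
  sum (λ j → sum (λ i → h i j))         ≡⟨ sumℚ≡sum {n} _ ⟨
  sumℚ (λ j → sum (λ i → h i j))        ≡⟨ sumℚ-cong (λ j → sumℚ≡sum (λ i → h i j)) ⟨
  sumℚ (λ j → sumℚ (λ i → h i j))       ∎
  where open ≡-Reasoning

sumℚ-mono-≤ : ∀ {n} {f g : Fin n → ℚ} → (∀ i → f i ≤ g i) → sumℚ f ≤ sumℚ g
sumℚ-mono-≤ {zero}  f≤g = ℚP.≤-refl
sumℚ-mono-≤ {suc n} f≤g = ℚP.+-mono-≤ (f≤g zero) (sumℚ-mono-≤ (f≤g ∘ suc))

p≤q⇒p-q≤0 : ∀ {p q} → p ≤ q → p - q ≤ 0ℚ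
p≤q⇒p-q≤0 {p} {q} p≤q = subst (p - q ≤_) (ℚP.+-inverseʳ q) (ℚP.+-monoˡ-≤ (- q) p≤q)

≤-shift : ∀ c {p q p′ q′} → p + c ≡ p′ → q + c ≡ q′ → p ≤ q → p′ ≤ q′
≤-shift c p+c≡p′ q+c≡q′ p≤q = subst₂ _≤_ p+c≡p′ q+c≡q′ (ℚP.+-monoˡ-≤ c p≤q)

if-nonneg : ∀ {p} t → 0ℚ ≤ p → 0ℚ ≤ (if t then p else 0ℚ)
if-nonneg true  0≤p = 0≤p
if-nonneg false _   = ℚP.≤-refl

basis : ∀ {n} → Fin n → ℚ → Pt n
basis i c k = if does (i ≟ k) then c else 0ℚ

sumℚ-basis : ∀ {n} (i : Fin n) c → sumℚ (basis i c) ≡ c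
sumℚ-basis {suc n} zero    c = trans (cong (c +_) (sumℚ-zero n)) (ℚP.+-identityʳ c)
sumℚ-basis {suc n} (suc i) c = trans (ℚP.+-identityˡ _) (sumℚ-basis i c)

basis-nonneg : ∀ {n} (i : Fin n) {c} k → 0ℚ ≤ c → 0ℚ ≤ basis i c k
basis-nonneg i k 0≤c with i ≟ k
... | yes _ = 0≤c
... | no  _ = ℚP.≤-refl

basis-support : ∀ {n} (i : Fin n) {c} k → basis i c k ≢ 0ℚ → i ≡ k × c ≢ 0ℚ
basis-support i k c≢0 with i ≟ k
... | yes i≡k = i≡k , c≢0
... | no  _   = contradiction refl c≢0

∉⇒lookup≡false : ∀ {n} {i : Fin n} {A} → i ∉ A → lookup A i ≡ false
∉⇒lookup≡false {i = i} {A} i∉A with lookup A i in eq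
... | true  = contradiction (lookup⇒[]= i A eq) i∉A
... | false = refl

restrict : ∀ {n} → Subset n → Pt n → Pt n
restrict A x k = if lookup A k then x k else 0ℚ

sumOver-cong : ∀ {n} (A : Subset n) {x y : Pt n} → x ≗ y → sumOver A x ≡ sumOver A y
sumOver-cong A x≗y = sumℚ-cong (λ k → cong (if lookup A k then_else 0ℚ) (x≗y k))

sumOver-+ : ∀ {n} (A : Subset n) (x y : Pt n) →
  sumOver A (λ k → x k + y k) ≡ sumOver A x + sumOver A y
sumOver-+ A x y = trans (sumℚ-cong (λ k → if-+ (lookup A k))) (sumℚ-+ (restrict A x) (restrict A y))
  where
  if-+ : ∀ {p q} t → (if t then p + q else 0ℚ) ≡ (if t then p else 0ℚ) + (if t then q else 0ℚ)
  if-+ true  = refl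
  if-+ false = refl

sumOver-- : ∀ {n} (A : Subset n) (x y : Pt n) →
  sumOver A (λ k → x k - y k) ≡ sumOver A x - sumOver A y
sumOver-- A x y = trans (sumℚ-cong (λ k → if-- (lookup A k))) (sumℚ-- (restrict A x) (restrict A y))
  where
  if-- : ∀ {p q} t → (if t then p - q else 0ℚ) ≡ (if t then p else 0ℚ) - (if t then q else 0ℚ)
  if-- true  = refl
  if-- false = refl

sumOver-basis : ∀ {n} (A : Subset n) i c → sumOver A (basis i c) ≡ (if lookup A i then c else 0ℚ)
sumOver-basis A i c = trans (sumℚ-cong restrict-basis) (sumℚ-basis i _)
  where
  restrict-basis : ∀ k → restrict A (basis i c) k ≡ basis i (if lookup A i then c else 0ℚ) k
  restrict-basis k with i ≟ k
  ... | yes refl = refl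
  ... | no  _    with lookup A k
  ...   | true  = refl
  ...   | false = refl

sumOver-modular : ∀ {n} (A B : Subset n) x →
  sumOver (A ∪ B) x + sumOver (A ∩ B) x ≡ sumOver A x + sumOver B x
sumOver-modular []      []      x = refl
sumOver-modular (a ∷ A) (b ∷ B) x = begin
  (x₀if (a ∨ b) + rest (A ∪ B)) + (x₀if (a ∧ b) + rest (A ∩ B))
    ≡⟨ ℚ+.interchange (x₀if (a ∨ b)) _ _ _ ⟩
  (x₀if (a ∨ b) + x₀if (a ∧ b)) + (rest (A ∪ B) + rest (A ∩ B))
    ≡⟨ cong₂ _+_ (head a b) (sumOver-modular A B (x ∘ suc)) ⟩
  (x₀if a + x₀if b) + (rest A + rest B)
    ≡⟨ ℚ+.interchange (x₀if a) _ _ _ ⟩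
  (x₀if a + rest A) + (x₀if b + rest B)
    ∎
  where
  open ≡-Reasoning
  rest : Subset _ → ℚ
  rest C = sumOver C (x ∘ suc)
  x₀if : Bool → ℚ
  x₀if t = if t then x zero else 0ℚ
  head : ∀ a b → x₀if (a ∨ b) + x₀if (a ∧ b) ≡ x₀if a + x₀if b
  head true  true  = refl
  head true  false = refl
  head false true  = ℚP.+-comm (x zero) 0ℚ
  head false false = refl

-- Flows and the recession cone

-- netInflow L = Σ_{a,b} L a b (e_b − e_a); the equation in InRec 𝒟 v reads v ≗ netInflow λ′.
netInflow : ∀ {n} → (Fin n → Fin n → ℚ) → Pt n
netInflow L k = sumℚ (λ i → L i k) - sumℚ (λ j → L k j)

flowInto flowOutOf : ∀ {n} → Subset n → (Fin n → Fin n → ℚ) → ℚ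
flowInto  A L = sumℚ (λ a → sumℚ (λ b → if lookup A b then L a b else 0ℚ))
flowOutOf A L = sumℚ (λ a → sumℚ (λ b → if lookup A a then L a b else 0ℚ))

sumOver-netInflow : ∀ {n} (A : Subset n) L → sumOver A (netInflow L) ≡ flowInto A L - flowOutOf A L
sumOver-netInflow {n} A L = begin
  sumOver A (netInflow L)
    ≡⟨ sumℚ-cong (λ k → restrict-netInflow (lookup A k)) ⟩
  sumℚ (λ k → sumℚ (λ i → if lookup A k then L i k else 0ℚ)
            - sumℚ (λ j → if lookup A k then L k j else 0ℚ))
    ≡⟨ sumℚ-- (λ k → sumℚ (λ i → if lookup A k then L i k else 0ℚ)) _ ⟩
  sumℚ (λ k → sumℚ (λ i → if lookup A k then L i k else 0ℚ))
    - sumℚ (λ k → sumℚ (λ j → if lookup A k then L k j else 0ℚ))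
    ≡⟨ cong (_- flowOutOf A L) (sumℚ-comm (λ k i → if lookup A k then L i k else 0ℚ)) ⟩
  flowInto A L - flowOutOf A L
    ∎
  where
  open ≡-Reasoning
  restrict-netInflow : ∀ {k} t → (if t then netInflow L k else 0ℚ)
    ≡ sumℚ (λ i → if t then L i k else 0ℚ) - sumℚ (λ j → if t then L k j else 0ℚ)
  restrict-netInflow true  = refl
  restrict-netInflow false = sym (cong₂ _-_ (sumℚ-zero n) (sumℚ-zero n))

sumOver-netInflow-≤0 : ∀ {n} (A : Subset n) L → (∀ a b → 0ℚ ≤ L a b) →
  (∀ a b → L a b ≢ 0ℚ → b ∈ A → a ∈ A) → sumOver A (netInflow L) ≤ 0ℚ
sumOver-netInflow-≤0 A L L≥0 closed = subst (_≤ 0ℚ) (sym (sumOver-netInflow A L))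
  (p≤q⇒p-q≤0 (sumℚ-mono-≤ (λ a → sumℚ-mono-≤ (λ b → into≤outOf a b))))
  where
  into≤outOf : ∀ a b → (if lookup A b then L a b else 0ℚ) ≤ (if lookup A a then L a b else 0ℚ)
  into≤outOf a b with lookup A b in b∈A | L a b ℚP.≟ 0ℚ
  ... | false | _      = if-nonneg (lookup A a) (L≥0 a b)
  ... | true  | yes L≡0 = subst (_≤ (if lookup A a then L a b else 0ℚ)) (sym L≡0)
                              (if-nonneg (lookup A a) (L≥0 a b))
  ... | true  | no  L≢0 rewrite []=⇒lookup (closed a b L≢0 (lookup⇒[]= b A b∈A)) = ℚP.≤-refl

sumOver-⊤-netInflow : ∀ {n} L → sumOver (Sub.⊤ {n}) (netInflow L) ≡ 0ℚ
sumOver-⊤-netInflow {n} L = begin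
  sumOver Sub.⊤ (netInflow L)          ≡⟨ sumOver-netInflow Sub.⊤ L ⟩
  flowInto Sub.⊤ L - flowOutOf Sub.⊤ L ≡⟨ cong₂ _-_ (total (λ a b → b)) (total (λ a b → a)) ⟩
  total′ - total′                       ≡⟨ ℚP.+-inverseʳ total′ ⟩
  0ℚ                                    ∎
  where
  open ≡-Reasoning
  total′ : ℚ
  total′ = sumℚ (λ a → sumℚ (λ b → L a b))
  total : (pick : Fin n → Fin n → Fin n) →
    sumℚ (λ a → sumℚ (λ b → if lookup (Sub.⊤ {n}) (pick a b) then L a b else 0ℚ)) ≡ total′
  total pick = sumℚ-cong λ a → sumℚ-cong λ b →
    cong (if_then L a b else 0ℚ) (lookup-replicate (pick a b) true)

netInflow-+ : ∀ {n} (L M : Fin n → Fin n → ℚ) k →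
  netInflow (λ a b → L a b + M a b) k ≡ netInflow L k + netInflow M k
netInflow-+ L M k = trans
  (cong₂ _-_ (sumℚ-+ (λ i → L i k) (λ i → M i k)) (sumℚ-+ (L k) (M k)))
  (solve 4 (λ a b c d → (a :+ b) :- (c :+ d) := (a :- c) :+ (b :- d)) refl
    (sumℚ (λ i → L i k)) (sumℚ (λ i → M i k)) (sumℚ (L k)) (sumℚ (M k)))

arcFlow : ∀ {n} → Fin n → Fin n → ℚ → Fin n → Fin n → ℚ
arcFlow i j c a b = basis i (basis j c b) a

netInflow-arcFlow : ∀ {n} (i j : Fin n) c k →
  netInflow (arcFlow i j c) k ≡ basis j c k - basis i c k
netInflow-arcFlow {n} i j c k = cong₂ _-_ (sumℚ-basis i (basis j c k)) outflow
  where
  outflow : sumℚ (λ b → basis i (basis j c b) k) ≡ basis i c k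
  outflow with i ≟ k
  ... | yes _ = sumℚ-basis j c
  ... | no  _ = sumℚ-zero n

-- Pushing flow along arcs in a submodular polyhedron

subsets : ∀ n → List (Subset n)
subsets zero    = [ [] ]
subsets (suc n) = map (true ∷_) (subsets n) ++ map (false ∷_) (subsets n)

∈-subsets : ∀ {n} (A : Subset n) → A ∈ₗ subsets n
∈-subsets []                  = here refl
∈-subsets (true  ∷ A)         = ∈-++⁺ˡ (∈-map⁺ (true ∷_) (∈-subsets A))
∈-subsets {suc n} (false ∷ A) =
  ∈-++⁺ʳ (map (true ∷_) (subsets n)) (∈-map⁺ (false ∷_) (∈-subsets A))

ClosedUnder : ∀ {n} → (Fin n → Fin n → Set) → List (Fin n × Fin n) → Subset n → Set
ClosedUnder R arcs A = All (λ (a , b) → R a b → b ∈ A → a ∈ A) arcs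

closedUnder? : ∀ {n} {R : Fin n → Fin n → Set} → (∀ a b → Dec (R a b)) →
  ∀ arcs → Decidable (ClosedUnder R arcs)
closedUnder? R? arcs A = all? (λ (a , b) → R? a b →-dec (b ∈? A →-dec a ∈? A)) arcs

module _ {n} {R : Fin n → Fin n → Set} {arcs : List (Fin n × Fin n)} {A B : Subset n} where

  ∪-closedUnder : ClosedUnder R arcs A → ClosedUnder R arcs B → ClosedUnder R arcs (A ∪ B)
  ∪-closedUnder cA cB = All.zipWith
    (λ (closedA , closedB) r b∈A∪B →
       x∈p∪q⁺ (Sum.map (closedA r) (closedB r) (x∈p∪q⁻ A B b∈A∪B)))
    (cA , cB)

  ∩-closedUnder : ClosedUnder R arcs A → ClosedUnder R arcs B → ClosedUnder R arcs (A ∩ B)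
  ∩-closedUnder cA cB = All.zipWith
    (λ (closedA , closedB) r b∈A∩B →
       x∈p∩q⁺ (Product.map (closedA r) (closedB r) (x∈p∩q⁻ A B b∈A∩B)))
    (cA , cB)

module SubmodularFlow {n : ℕ} (f : Subset n → ℚ)
  (f-submodular : ∀ A B → f (A ∪ B) + f (A ∩ B) ≤ f A + f B)
  {R : Fin n → Fin n → Set} (R? : ∀ a b → Dec (R a b)) where

  record Decomposition (x : Pt n) : Set where
    field
      base : Pt n
      flow : Fin n → Fin n → ℚ
      base-≤ : ∀ A → sumOver A base ≤ f A
      base-⊤ : sumOver Sub.⊤ base ≡ f Sub.⊤
      flow-nonneg : ∀ a b → 0ℚ ≤ flow a b
      flow-along-R : ∀ a b → flow a b ≢ 0ℚ → R a b
      decomposes : ∀ k → x k ≡ base k + netInflow flow k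

  module Push (arcs : List (Fin n × Fin n)) (i j : Fin n) (x : Pt n)
    (x-≤ : ∀ A → ClosedUnder R ((i , j) ∷ arcs) A → sumOver A x ≤ f A) where

    Violating : Subset n → Set
    Violating A = ClosedUnder R arcs A × j ∈ A × i ∉ A

    violating? : Decidable Violating
    violating? A = closedUnder? R? arcs A ×-dec j ∈? A ×-dec ¬? (i ∈? A)

    excess : Subset n → ℚ
    excess A = sumOver A x - f A

    excesses : List ℚ
    excesses = map excess (filter violating? (subsets n))

    -- The largest violation among the sets that lose the protection of the arc (i , j).
    ε : ℚ
    ε = max 0ℚ excesses

    ε-nonneg : 0ℚ ≤ ε
    ε-nonneg = v≤max⁺ 0ℚ excesses (inj₁ ℚP.≤-refl)

    excess≤ε : ∀ {A} → Violating A → excess A ≤ ε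
    excess≤ε {A} vA = All.lookup (xs≤max 0ℚ excesses)
      (∈-map∘filter⁺ excess violating? (A , ∈-subsets A , refl , vA))

    ε-attained : ε ≡ 0ℚ ⊎ ∃ λ B → Violating B × ε ≡ excess B
    ε-attained with argmax-sel id 0ℚ excesses
    ... | inj₁ ε≡0 = inj₁ ε≡0
    ... | inj₂ ε∈  =
      let (B , _ , ε≡ , vB) = ∈-map∘filter⁻ excess violating? {xs = subsets n} ε∈
      in inj₂ (B , vB , ε≡)

    exchange : ∀ {A B} → ClosedUnder R arcs A → ClosedUnder R arcs B → i ∈ A → j ∉ A →
      sumOver A x + sumOver B x ≤ f A + f B
    exchange {A} {B} cA cB i∈A j∉A = begin
      sumOver A x + sumOver B x
        ≡⟨ sumOver-modular A B x ⟨
      sumOver (A ∪ B) x + sumOver (A ∩ B) x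
        ≤⟨ ℚP.+-mono-≤ (x-≤ (A ∪ B) closed∪) (x-≤ (A ∩ B) closed∩) ⟩
      f (A ∪ B) + f (A ∩ B)
        ≤⟨ f-submodular A B ⟩
      f A + f B
        ∎
      where
      open ℚP.≤-Reasoning
      closed∪ : ClosedUnder R ((i , j) ∷ arcs) (A ∪ B)
      closed∪ = (λ _ _ → x∈p∪q⁺ (inj₁ i∈A)) ∷ ∪-closedUnder cA cB
      closed∩ : ClosedUnder R ((i , j) ∷ arcs) (A ∩ B)
      closed∩ = (λ _ j∈A∩B → contradiction (proj₁ (x∈p∩q⁻ A B j∈A∩B)) j∉A) ∷ ∩-closedUnder cA cB

    pushed : Pt n
    pushed k = x k - netInflow (arcFlow i j ε) k

    sumOver-pushed : ∀ A → sumOver A pushed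
      ≡ sumOver A x - (if lookup A j then ε else 0ℚ) + (if lookup A i then ε else 0ℚ)
    sumOver-pushed A = begin
      sumOver A pushed
        ≡⟨ sumOver-- A x (netInflow (arcFlow i j ε)) ⟩
      sumOver A x - sumOver A (netInflow (arcFlow i j ε))
        ≡⟨ cong (λ s → sumOver A x - s) arcSum ⟩
      sumOver A x - (ε[ j ] - ε[ i ])
        ≡⟨ solve 3 (λ a p q → a :- (p :- q) := a :- p :+ q) refl (sumOver A x) ε[ j ] ε[ i ] ⟩
      sumOver A x - ε[ j ] + ε[ i ]
        ∎
      where
      open ≡-Reasoning
      ε[_] : Fin n → ℚ
      ε[ k ] = if lookup A k then ε else 0ℚ
      arcSum : sumOver A (netInflow (arcFlow i j ε)) ≡ ε[ j ] - ε[ i ]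
      arcSum = trans (sumOver-cong A (netInflow-arcFlow i j ε))
        (trans (sumOver-- A (basis j ε) (basis i ε))
               (cong₂ _-_ (sumOver-basis A j ε) (sumOver-basis A i ε)))

    pushed-≤ : ∀ A → ClosedUnder R arcs A → sumOver A pushed ≤ f A
    pushed-≤ A cA = subst (_≤ f A) (sym (sumOver-pushed A)) (cases (j ∈? A) (i ∈? A))
      where
      a = sumOver A x
      b = f A
      unchanged : ∀ p q → i ∈ A ⊎ j ∉ A → a - p + q ≡ a → a - p + q ≤ b
      unchanged _ _ i∈A⊎j∉A eq = subst (_≤ b) (sym eq)
        (x-≤ A ((λ _ j∈A → Sum.[ id , (λ j∉A → contradiction j∈A j∉A) ] i∈A⊎j∉A) ∷ cA))
      cases : Dec (j ∈ A) → Dec (i ∈ A) →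
        a - (if lookup A j then ε else 0ℚ) + (if lookup A i then ε else 0ℚ) ≤ b
      cases (yes j∈A) (yes i∈A) rewrite []=⇒lookup j∈A | []=⇒lookup i∈A =
        unchanged ε ε (inj₁ i∈A) (solve 2 (λ a e → a :- e :+ e := a) refl a ε)
      cases (yes j∈A) (no i∉A) rewrite []=⇒lookup j∈A | ∉⇒lookup≡false i∉A =
        ≤-shift (b - ε) (solve 3 (λ a b e → (a :- b) :+ (b :- e) := a :- e :+ con 0ℚ) refl a b ε)
                        (solve 2 (λ b e → e :+ (b :- e) := b) refl b ε)
                        (excess≤ε (cA , j∈A , i∉A))
      cases (no j∉A) (no i∉A) rewrite ∉⇒lookup≡false j∉A | ∉⇒lookup≡false i∉A =
        unchanged 0ℚ 0ℚ (inj₂ j∉A) (solve 1 (λ a → a :- con 0ℚ :+ con 0ℚ := a) refl a)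
      cases (no j∉A) (yes i∈A) rewrite ∉⇒lookup≡false j∉A | []=⇒lookup i∈A with ε-attained
      ... | inj₁ ε≡0 = subst (λ e → a - 0ℚ + e ≤ b) (sym ε≡0)
        (unchanged 0ℚ 0ℚ (inj₂ j∉A) (solve 1 (λ a → a :- con 0ℚ :+ con 0ℚ := a) refl a))
      ... | inj₂ (B , (cB , _) , ε≡) = subst (λ e → a - 0ℚ + e ≤ b) (sym ε≡)
        (≤-shift (- f B)
          (solve 3 (λ a c d → (a :+ c) :+ (:- d) := a :- con 0ℚ :+ (c :- d)) refl
                   a (sumOver B x) (f B))
          (solve 2 (λ b d → (b :+ d) :+ (:- d) := b) refl b (f B))
          (exchange cA cB i∈A j∉A))

    pushed-⊤ : sumOver Sub.⊤ x ≡ f Sub.⊤ → sumOver Sub.⊤ pushed ≡ f Sub.⊤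
    pushed-⊤ x-⊤ = begin
      sumOver Sub.⊤ pushed
        ≡⟨ sumOver-- Sub.⊤ x _ ⟩
      sumOver Sub.⊤ x - sumOver Sub.⊤ (netInflow (arcFlow i j ε))
        ≡⟨ cong₂ _-_ x-⊤ (sumOver-⊤-netInflow (arcFlow i j ε)) ⟩
      f Sub.⊤ - 0ℚ
        ≡⟨ ℚP.+-identityʳ (f Sub.⊤) ⟩
      f Sub.⊤
        ∎
      where open ≡-Reasoning

    unpush : R i j → Decomposition pushed → Decomposition x
    unpush Rij d = record
      { base = base
      ; flow = flow′
      ; base-≤ = base-≤
      ; base-⊤ = base-⊤
      ; flow-nonneg = λ a b →
          ℚP.+-mono-≤ (flow-nonneg a b) (basis-nonneg i a (basis-nonneg j b ε-nonneg))
      ; flow-along-R = flow′-along-R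
      ; decomposes = decomposes′
      }
      where
      open Decomposition d
      flow′ : Fin n → Fin n → ℚ
      flow′ a b = flow a b + arcFlow i j ε a b
      flow′-along-R : ∀ a b → flow′ a b ≢ 0ℚ → R a b
      flow′-along-R a b flow′≢0 with flow a b ℚP.≟ 0ℚ
      ... | no  flow≢0 = flow-along-R a b flow≢0
      ... | yes flow≡0 =
        let arc≢0 = λ arc≡0 → flow′≢0 (cong₂ _+_ flow≡0 arc≡0)
            (i≡a , inner≢0) = basis-support i a arc≢0
            (j≡b , _)       = basis-support j b inner≢0
        in subst₂ R i≡a j≡b Rij
      decomposes′ : ∀ k → x k ≡ base k + netInflow flow′ k
      decomposes′ k = begin
        x k                              ≡⟨ solve 2 (λ a v → a := (a :- v) :+ v) refl (x k) arc ⟩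
        pushed k + arc                   ≡⟨ cong (_+ arc) (decomposes k) ⟩
        (base k + netInflow flow k) + arc ≡⟨ ℚP.+-assoc (base k) _ _ ⟩
        base k + (netInflow flow k + arc) ≡⟨ cong (base k +_) (netInflow-+ flow (arcFlow i j ε) k) ⟨
        base k + netInflow flow′ k       ∎
        where
        open ≡-Reasoning
        arc = netInflow (arcFlow i j ε) k

  decompose : ∀ arcs x → (∀ A → ClosedUnder R arcs A → sumOver A x ≤ f A) →
    sumOver Sub.⊤ x ≡ f Sub.⊤ → Decomposition x
  decompose [] x x-≤ x-⊤ = record
    { base = x
    ; flow = λ _ _ → 0ℚ
    ; base-≤ = λ A → x-≤ A []
    ; base-⊤ = x-⊤
    ; flow-nonneg = λ _ _ → ℚP.≤-refl
    ; flow-along-R = λ _ _ 0≢0 → contradiction refl 0≢0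
    ; decomposes = λ k → sym (trans (cong (x k +_) (no-flow {k})) (ℚP.+-identityʳ (x k)))
    }
    where
    no-flow : ∀ {k} → netInflow {n} (λ _ _ → 0ℚ) k ≡ 0ℚ
    no-flow = cong₂ _-_ (sumℚ-zero n) (sumℚ-zero n)
  decompose ((i , j) ∷ arcs) x x-≤ x-⊤ with R? i j
  ... | no ¬Rij = decompose arcs x (λ A cA → x-≤ A ((λ Rij → contradiction Rij ¬Rij) ∷ cA)) x-⊤
  ... | yes Rij = unpush Rij (decompose arcs pushed pushed-≤ (pushed-⊤ x-⊤))
    where open Push arcs i j x x-≤

-- Down-sets

x∈⋂⁺ : ∀ {n} {x : Fin n} {Bs} → All (x ∈_) Bs → x ∈ ⋂ Bs
x∈⋂⁺ []           = ∈⊤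
x∈⋂⁺ (x∈B ∷ x∈Bs) = x∈p∩q⁺ (x∈B , x∈⋂⁺ x∈Bs)

x∈⋂⁻ : ∀ {n} {x : Fin n} Bs → x ∈ ⋂ Bs → All (x ∈_) Bs
x∈⋂⁻ []       _    = []
x∈⋂⁻ (B ∷ Bs) x∈⋂ = let (x∈B , x∈⋂Bs) = x∈p∩q⁻ B (⋂ Bs) x∈⋂ in x∈B ∷ x∈⋂⁻ Bs x∈⋂Bs

x∈⋃⁺ : ∀ {n} {x : Fin n} {Bs} → Any (x ∈_) Bs → x ∈ ⋃ Bs
x∈⋃⁺ (here x∈B)   = x∈p∪q⁺ (inj₁ x∈B)
x∈⋃⁺ (there x∈Bs) = x∈p∪q⁺ (inj₂ (x∈⋃⁺ x∈Bs))

x∈⋃⁻ : ∀ {n} {x : Fin n} Bs → x ∈ ⋃ Bs → Any (x ∈_) Bs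
x∈⋃⁻ []       x∈⊥ = contradiction x∈⊥ ∉⊥
x∈⋃⁻ (B ∷ Bs) x∈⋃ = Sum.[ here , there ∘ x∈⋃⁻ Bs ]′ (x∈p∪q⁻ B (⋃ Bs) x∈⋃)

module Downsets {n} {𝒟 : Family n} (L : AccessibleDistributiveLattice 𝒟) where
  open AccessibleDistributiveLattice L

  ⋂-∈𝒟 : ∀ {Bs} → All (_∈𝒟 𝒟) Bs → ⋂ Bs ∈𝒟 𝒟
  ⋂-∈𝒟 []             = has-E
  ⋂-∈𝒟 (B∈𝒟 ∷ Bs∈𝒟) = ∩-closed _ _ B∈𝒟 (⋂-∈𝒟 Bs∈𝒟)

  ⋃-∈𝒟 : ∀ {Bs} → All (_∈𝒟 𝒟) Bs → ⋃ Bs ∈𝒟 𝒟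
  ⋃-∈𝒟 []             = has-∅
  ⋃-∈𝒟 (B∈𝒟 ∷ Bs∈𝒟) = ∪-closed _ _ B∈𝒟 (⋃-∈𝒟 Bs∈𝒟)

  MemberContaining : Fin n → Subset n → Set
  MemberContaining j B = B ∈𝒟 𝒟 × j ∈ B

  memberContaining? : ∀ j → Decidable (MemberContaining j)
  memberContaining? j B = 𝒟 B Bool.≟ true ×-dec j ∈? B

  downset : Fin n → Subset n
  downset j = ⋂ (filter (memberContaining? j) (subsets n))

  downset-∈𝒟 : ∀ j → downset j ∈𝒟 𝒟
  downset-∈𝒟 j = ⋂-∈𝒟 (All.map proj₁ (all-filter (memberContaining? j) (subsets n)))

  j∈downset : ∀ j → j ∈ downset j
  j∈downset j = x∈⋂⁺ (All.map proj₂ (all-filter (memberContaining? j) (subsets n)))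

  downset-least : ∀ {j B} → B ∈𝒟 𝒟 → j ∈ B → downset j ⊆ B
  downset-least {j} {B} B∈𝒟 j∈B i∈downset = All.lookup (x∈⋂⁻ _ i∈downset)
    (∈-filter⁺ (memberContaining? j) (∈-subsets B) (B∈𝒟 , j∈B))

  ∈downset⇒≤ : ∀ {i j} → i ∈ downset j → i ≤[ 𝒟 ] j
  ∈downset⇒≤ i∈downset A A∈𝒟 j∈A = downset-least A∈𝒟 j∈A i∈downset

  downClosed⇒∈𝒟 : ∀ {A} → (∀ {i j} → i ∈ downset j → j ∈ A → i ∈ A) → A ∈𝒟 𝒟
  downClosed⇒∈𝒟 {A} closed = subst (_∈𝒟 𝒟) (⊆-antisym ⋃downsets⊆A A⊆⋃downsets)
    (⋃-∈𝒟 (All.map⁺ (All.universal downset-∈𝒟 (filter (_∈? A) (allFin n)))))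
    where
    ⋃downsets : Subset n
    ⋃downsets = ⋃ (map downset (filter (_∈? A) (allFin n)))
    A⊆⋃downsets : A ⊆ ⋃downsets
    A⊆⋃downsets {i} i∈A =
      x∈⋃⁺ (lose (∈-map⁺ downset (∈-filter⁺ (_∈? A) (∈-allFin i) i∈A)) (j∈downset i))
    ⋃downsets⊆A : ⋃downsets ⊆ A
    ⋃downsets⊆A i∈⋃ =
      let (B , B∈ , i∈B) = find (x∈⋃⁻ (map downset (filter (_∈? A) (allFin n))) i∈⋃)
          (j , _ , B≡downset , j∈A) = ∈-map∘filter⁻ downset (_∈? A) {xs = allFin n} B∈
      in closed (subst (_ ∈_) B≡downset i∈B) j∈A

  Below : Fin n → Fin n → Set
  Below i j = i ∈ downset j × i ≢ j

  below? : ∀ i j → Dec (Below i j)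
  below? i j = i ∈? downset j ×-dec ¬? (i ≟ j)

  allArcs : List (Fin n × Fin n)
  allArcs = cartesianProduct (allFin n) (allFin n)

  closedUnder-allArcs⇒∈𝒟 : ∀ {A} → ClosedUnder Below allArcs A → A ∈𝒟 𝒟
  closedUnder-allArcs⇒∈𝒟 closed = downClosed⇒∈𝒟 λ {i} {j} i∈downset j∈A → case i ≟ j of λ where
    (yes refl) → j∈A
    (no  i≢j)  → All.lookup closed (∈-cartesianProduct⁺ (∈-allFin i) (∈-allFin j))
                   (i∈downset , i≢j) j∈A

-- Base polyhedra

ℕtoℚ≃ : ∀ k → toℚᵘ (ℕtoℚ k) ≃ᵘ mkℚᵘ (ℤ.+ k) 0
ℕtoℚ≃ k = ℚP.toℚᵘ-fromℚᵘ (mkℚᵘ (ℤ.+ k) 0)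

ℕtoℚ-+ : ∀ a b → ℕtoℚ (a ℕ.+ b) ≡ ℕtoℚ a + ℕtoℚ b
ℕtoℚ-+ a b = ℚP.toℚᵘ-injective (begin
  toℚᵘ (ℕtoℚ (a ℕ.+ b))              ≈⟨ ℕtoℚ≃ (a ℕ.+ b) ⟩
  mkℚᵘ (ℤ.+ (a ℕ.+ b)) 0             ≈⟨ *≡* numerators ⟩
  mkℚᵘ (ℤ.+ a) 0 ℚᵘ.+ mkℚᵘ (ℤ.+ b) 0 ≈⟨ ℚᵘP.+-cong (ℕtoℚ≃ a) (ℕtoℚ≃ b) ⟨
  toℚᵘ (ℕtoℚ a) ℚᵘ.+ toℚᵘ (ℕtoℚ b)   ≈⟨ ℚP.toℚᵘ-homo-+ (ℕtoℚ a) (ℕtoℚ b) ⟨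
  toℚᵘ (ℕtoℚ a + ℕtoℚ b)             ∎)
  where
  open ℚᵘP.≃-Reasoning
  open ℤSolver using () renaming (solve to solveℤ; _:+_ to _⊕_; _:*_ to _⊗_; _:=_ to _⊜_; con to κ)
  numerators : ℤ.+ (a ℕ.+ b) ℤ.* 1ℤ ≡ (ℤ.+ a ℤ.* 1ℤ ℤ.+ ℤ.+ b ℤ.* 1ℤ) ℤ.* 1ℤ
  numerators = trans (cong (ℤ._* 1ℤ) (ℤP.pos-+ a b))
    (solveℤ 2 (λ x y → (x ⊕ y) ⊗ κ 1ℤ ⊜ (x ⊗ κ 1ℤ ⊕ y ⊗ κ 1ℤ) ⊗ κ 1ℤ) refl (ℤ.+ a) (ℤ.+ b))

ℕtoℚ-mono-≤ : ∀ {a b} → a ℕ.≤ b → ℕtoℚ a ≤ ℕtoℚ b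
ℕtoℚ-mono-≤ {a} {b} a≤b = ℚP.toℚᵘ-cancel-≤
  (ℚᵘP.≤-respʳ-≃ (ℚᵘP.≃-sym (ℕtoℚ≃ b)) (ℚᵘP.≤-respˡ-≃ (ℚᵘP.≃-sym (ℕtoℚ≃ a))
    (*≤* (ℤP.*-monoʳ-≤-nonNeg 1ℤ (ℤ.+≤+ a≤b)))))

Submodular : ∀ {n} → (Subset n → ℕ) → Set
Submodular r = ∀ A B → r (A ∪ B) ℕ.+ r (A ∩ B) ℕ.≤ r A ℕ.+ r B

ℕtoℚ-submodular : ∀ {n} {r : Subset n → ℕ} → Submodular r →
  ∀ A B → ℕtoℚ (r (A ∪ B)) + ℕtoℚ (r (A ∩ B)) ≤ ℕtoℚ (r A) + ℕtoℚ (r B)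
ℕtoℚ-submodular {r = r} r-submodular A B = subst₂ _≤_
  (ℕtoℚ-+ (r (A ∪ B)) (r (A ∩ B))) (ℕtoℚ-+ (r A) (r B)) (ℕtoℚ-mono-≤ (r-submodular A B))

base+rec⊆base : ∀ {n} {𝒟 : Family n} {r} x → InBasePlusRec 𝒟 r x → InBase 𝒟 r x
base+rec⊆base {𝒟 = 𝒟} {r} x (y , v , (y-≤ , y-⊤) , (L , L≥0 , L-along , v≡netInflow) , x≡y+v) =
  x-≤ , x-⊤
  where
  split : ∀ A → sumOver A x ≡ sumOver A y + sumOver A (netInflow L)
  split A = trans (sumOver-cong A x≡y+v)
    (trans (sumOver-+ A y v) (cong (sumOver A y +_) (sumOver-cong A v≡netInflow)))
  x-≤ : ∀ A → A ∈𝒟 𝒟 → sumOver A x ≤ ℕtoℚ (r A)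
  x-≤ A A∈𝒟 = subst₂ _≤_ (sym (split A)) (ℚP.+-identityʳ (ℕtoℚ (r A)))
    (ℚP.+-mono-≤ (y-≤ A refl)
      (sumOver-netInflow-≤0 A L L≥0 (λ a b L≢0 b∈A → proj₁ (L-along a b L≢0) A A∈𝒟 b∈A)))
  x-⊤ : sumOver Sub.⊤ x ≡ ℕtoℚ (r Sub.⊤)
  x-⊤ = trans (split Sub.⊤)
    (trans (cong₂ _+_ y-⊤ (sumOver-⊤-netInflow L)) (ℚP.+-identityʳ (ℕtoℚ (r Sub.⊤))))

module _ {n} {𝒟 : Family n} (L : AccessibleDistributiveLattice 𝒟)
  {r : Subset n → ℕ} (r-submodular : Submodular r) where
  open Downsets L
  open SubmodularFlow (ℕtoℚ ∘ r) (ℕtoℚ-submodular {r = r} r-submodular) below?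

  base⊆base+rec : ∀ x → InBase 𝒟 r x → InBasePlusRec 𝒟 r x
  base⊆base+rec x (x-≤ , x-⊤) =
    base , netInflow flow , ((λ A _ → base-≤ A) , base-⊤) ,
    (flow , flow-nonneg , flow-along-P , λ _ → refl) , decomposes
    where
    open Decomposition
      (decompose allArcs x (λ A closed → x-≤ A (closedUnder-allArcs⇒∈𝒟 closed)) x-⊤)
    flow-along-P : ∀ a b → flow a b ≢ 0ℚ → b >[ 𝒟 ] a
    flow-along-P a b flow≢0 = Product.map₁ ∈downset⇒≤ (flow-along-R a b flow≢0)

  base≐base+rec : InBase 𝒟 r ≐ InBasePlusRec 𝒟 r
  base≐base+rec x = base⊆base+rec x , base+rec⊆base {𝒟 = 𝒟} {r} x

-- Extending a U-matroid to a matroid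

p─p≡⊥ : ∀ {n} (p : Subset n) → p ─ p ≡ Sub.⊥
p─p≡⊥ []          = refl
p─p≡⊥ (true  ∷ p) = cong (false ∷_) (p─p≡⊥ p)
p─p≡⊥ (false ∷ p) = cong (false ∷_) (p─p≡⊥ p)

x∈p─q⇒x∉q : ∀ {n} {x : Fin n} (p q : Subset n) → x ∈ p ─ q → x ∉ q
x∈p─q⇒x∉q (_ ∷ p) (false ∷ q) here ()
x∈p─q⇒x∉q (_ ∷ p) (_ ∷ q) (there x∈p─q) (there x∈q) = x∈p─q⇒x∉q p q x∈p─q x∈q

─-monoˡ-⊆ : ∀ {n} {p q : Subset n} r → p ⊆ q → p ─ r ⊆ q ─ r
─-monoˡ-⊆ {p = p} r p⊆q x∈p─r = x∈p∧x∉q⇒x∈p─q (p⊆q (p─q⊆p p r x∈p─r)) (x∈p─q⇒x∉q p r x∈p─r)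

∣p∪q∣+∣p∩q∣≡∣p∣+∣q∣ : ∀ {n} (p q : Subset n) → ∣ p ∪ q ∣ ℕ.+ ∣ p ∩ q ∣ ≡ ∣ p ∣ ℕ.+ ∣ q ∣
∣p∪q∣+∣p∩q∣≡∣p∣+∣q∣ []          []          = refl
∣p∪q∣+∣p∩q∣≡∣p∣+∣q∣ (true  ∷ p) (true  ∷ q) = cong suc (trans (ℕP.+-suc ∣ p ∪ q ∣ ∣ p ∩ q ∣)
  (trans (cong suc (∣p∪q∣+∣p∩q∣≡∣p∣+∣q∣ p q)) (sym (ℕP.+-suc ∣ p ∣ ∣ q ∣))))
∣p∪q∣+∣p∩q∣≡∣p∣+∣q∣ (true  ∷ p) (false ∷ q) = cong suc (∣p∪q∣+∣p∩q∣≡∣p∣+∣q∣ p q)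
∣p∪q∣+∣p∩q∣≡∣p∣+∣q∣ (false ∷ p) (true  ∷ q) =
  trans (cong suc (∣p∪q∣+∣p∩q∣≡∣p∣+∣q∣ p q)) (sym (ℕP.+-suc ∣ p ∣ ∣ q ∣))
∣p∪q∣+∣p∩q∣≡∣p∣+∣q∣ (false ∷ p) (false ∷ q) = ∣p∪q∣+∣p∩q∣≡∣p∣+∣q∣ p q

x∈p─q⁻ : ∀ {n} {x : Fin n} (p q : Subset n) → x ∈ p ─ q → x ∈ p × x ∉ q
x∈p─q⁻ p q x∈p─q = p─q⊆p p q x∈p─q , x∈p─q⇒x∉q p q x∈p─q

∣p∪q∣≤∣p∣+∣q∣ : ∀ {n} (p q : Subset n) → ∣ p ∪ q ∣ ℕ.≤ ∣ p ∣ ℕ.+ ∣ q ∣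
∣p∪q∣≤∣p∣+∣q∣ p q =
  ℕP.≤-trans (ℕP.m≤m+n ∣ p ∪ q ∣ ∣ p ∩ q ∣) (ℕP.≤-reflexive (∣p∪q∣+∣p∩q∣≡∣p∣+∣q∣ p q))

∣─∣-submodular : ∀ {n} (X Y B C : Subset n) →
  ∣ (X ∪ Y) ─ (B ∪ C) ∣ ℕ.+ ∣ (X ∩ Y) ─ (B ∩ C) ∣ ℕ.≤ ∣ X ─ B ∣ ℕ.+ ∣ Y ─ C ∣
∣─∣-submodular X Y B C = begin
  ∣ S₁ ∣ ℕ.+ ∣ S₂ ∣             ≡⟨ ∣p∪q∣+∣p∩q∣≡∣p∣+∣q∣ S₁ S₂ ⟨
  ∣ S₁ ∪ S₂ ∣ ℕ.+ ∣ S₁ ∩ S₂ ∣   ≤⟨ ℕP.+-mono-≤ (p⊆q⇒∣p∣≤∣q∣ S₁∪S₂⊆U∪V) (p⊆q⇒∣p∣≤∣q∣ S₁∩S₂⊆U∩V) ⟩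
  ∣ U ∪ V ∣ ℕ.+ ∣ U ∩ V ∣       ≡⟨ ∣p∪q∣+∣p∩q∣≡∣p∣+∣q∣ U V ⟩
  ∣ U ∣ ℕ.+ ∣ V ∣               ∎
  where
  open ℕP.≤-Reasoning
  S₁ = (X ∪ Y) ─ (B ∪ C)
  S₂ = (X ∩ Y) ─ (B ∩ C)
  U = X ─ B
  V = Y ─ C
  S₁∪S₂⊆U∪V : S₁ ∪ S₂ ⊆ U ∪ V
  S₁∪S₂⊆U∪V {e} e∈S₁∪S₂ with x∈p∪q⁻ S₁ S₂ e∈S₁∪S₂
  ... | inj₁ e∈S₁ =
    let (e∈X∪Y , e∉B∪C) = x∈p─q⁻ (X ∪ Y) (B ∪ C) e∈S₁
    in x∈p∪q⁺ (Sum.map (λ e∈X → x∈p∧x∉q⇒x∈p─q e∈X (e∉B∪C ∘ x∈p∪q⁺ ∘ inj₁))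
                       (λ e∈Y → x∈p∧x∉q⇒x∈p─q e∈Y (e∉B∪C ∘ x∈p∪q⁺ ∘ inj₂))
                       (x∈p∪q⁻ X Y e∈X∪Y))
  ... | inj₂ e∈S₂ with x∈p─q⁻ (X ∩ Y) (B ∩ C) e∈S₂ | e ∈? B
  ...   | e∈X∩Y , e∉B∩C | yes e∈B = x∈p∪q⁺ (inj₂ (x∈p∧x∉q⇒x∈p─q (proj₂ (x∈p∩q⁻ X Y e∈X∩Y))
                                                  (λ e∈C → e∉B∩C (x∈p∩q⁺ (e∈B , e∈C)))))
  ...   | e∈X∩Y , _     | no  e∉B = x∈p∪q⁺ (inj₁ (x∈p∧x∉q⇒x∈p─q (proj₁ (x∈p∩q⁻ X Y e∈X∩Y)) e∉B))
  S₁∩S₂⊆U∩V : S₁ ∩ S₂ ⊆ U ∩ V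
  S₁∩S₂⊆U∩V e∈S₁∩S₂ =
    let (e∈S₁ , e∈S₂) = x∈p∩q⁻ S₁ S₂ e∈S₁∩S₂
        e∉B∪C = proj₂ (x∈p─q⁻ (X ∪ Y) (B ∪ C) e∈S₁)
        (e∈X , e∈Y) = x∈p∩q⁻ X Y (proj₁ (x∈p─q⁻ (X ∩ Y) (B ∩ C) e∈S₂))
    in x∈p∩q⁺ ( x∈p∧x∉q⇒x∈p─q e∈X (e∉B∪C ∘ x∈p∪q⁺ ∘ inj₁)
              , x∈p∧x∉q⇒x∈p─q e∈Y (e∉B∪C ∘ x∈p∪q⁺ ∘ inj₂))

∣p∪⁅x⁆─q∣≤1+∣p─q∣ : ∀ {n} (p q : Subset n) x → ∣ (p ∪ ⁅ x ⁆) ─ q ∣ ℕ.≤ suc ∣ p ─ q ∣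
∣p∪⁅x⁆─q∣≤1+∣p─q∣ p q x = begin
  ∣ (p ∪ ⁅ x ⁆) ─ q ∣      ≤⟨ p⊆q⇒∣p∣≤∣q∣ ⊆p─q∪⁅x⁆ ⟩
  ∣ (p ─ q) ∪ ⁅ x ⁆ ∣      ≤⟨ ∣p∪q∣≤∣p∣+∣q∣ (p ─ q) ⁅ x ⁆ ⟩
  ∣ p ─ q ∣ ℕ.+ ∣ ⁅ x ⁆ ∣  ≡⟨ trans (cong (∣ p ─ q ∣ ℕ.+_) (∣⁅x⁆∣≡1 x)) (ℕP.+-comm ∣ p ─ q ∣ 1) ⟩
  suc ∣ p ─ q ∣            ∎
  where
  open ℕP.≤-Reasoning
  ⊆p─q∪⁅x⁆ : (p ∪ ⁅ x ⁆) ─ q ⊆ (p ─ q) ∪ ⁅ x ⁆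
  ⊆p─q∪⁅x⁆ y∈ = let (y∈p∪⁅x⁆ , y∉q) = x∈p─q⁻ (p ∪ ⁅ x ⁆) q y∈
    in x∈p∪q⁺ (Sum.map₁ (λ y∈p → x∈p∧x∉q⇒x∈p─q y∈p y∉q) (x∈p∪q⁻ p ⁅ x ⁆ y∈p∪⁅x⁆))

∖⁅⁆≡─⁅⁆ : ∀ {n} (A : Subset n) x → A ∖⁅ x ⁆ ≡ A ─ ⁅ x ⁆
∖⁅⁆≡─⁅⁆ (a ∷ A) zero    = cong (false ∷_) (sym (p─⊥≡p A))
∖⁅⁆≡─⁅⁆ (a ∷ A) (suc x) = cong (a ∷_) (∖⁅⁆≡─⁅⁆ A x)

p∪[q─⁅x⁆]∪⁅x⁆≡p∪q : ∀ {n} (C A : Subset n) {x} → x ∈ A → (C ∪ (A ─ ⁅ x ⁆)) ∪ ⁅ x ⁆ ≡ C ∪ A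
p∪[q─⁅x⁆]∪⁅x⁆≡p∪q C A {x} x∈A = ⊆-antisym ⊆C∪A ⊇C∪A
  where
  ⊆C∪A : (C ∪ (A ─ ⁅ x ⁆)) ∪ ⁅ x ⁆ ⊆ C ∪ A
  ⊆C∪A y∈ with x∈p∪q⁻ (C ∪ (A ─ ⁅ x ⁆)) ⁅ x ⁆ y∈
  ... | inj₁ y∈C∪A─x = x∈p∪q⁺ (Sum.map₂ (p─q⊆p A ⁅ x ⁆) (x∈p∪q⁻ C (A ─ ⁅ x ⁆) y∈C∪A─x))
  ... | inj₂ y∈⁅x⁆   = x∈p∪q⁺ (inj₂ (subst (_∈ A) (sym (x∈⁅y⁆⇒x≡y x y∈⁅x⁆)) x∈A))
  ⊇C∪A : C ∪ A ⊆ (C ∪ (A ─ ⁅ x ⁆)) ∪ ⁅ x ⁆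
  ⊇C∪A {y} y∈ with x∈p∪q⁻ C A y∈ | y ≟ x
  ... | inj₁ y∈C | _        = x∈p∪q⁺ (inj₁ (x∈p∪q⁺ (inj₁ y∈C)))
  ... | inj₂ _   | yes refl = x∈p∪q⁺ (inj₂ (x∈⁅x⁆ x))
  ... | inj₂ y∈A | no  y≢x  = x∈p∪q⁺ (inj₁ (x∈p∪q⁺ (inj₂ (x∈p∧x≢y⇒x∈p-y y∈A y≢x))))

p∪q⊆p∪[q─⁅x⁆] : ∀ {n} (C A : Subset n) {x} → x ∈ C → C ∪ A ⊆ C ∪ (A ─ ⁅ x ⁆)
p∪q⊆p∪[q─⁅x⁆] C A {x} x∈C {y} y∈ with x∈p∪q⁻ C A y∈ | y ≟ x
... | inj₁ y∈C | _        = x∈p∪q⁺ (inj₁ y∈C)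
... | inj₂ _   | yes refl = x∈p∪q⁺ (inj₁ x∈C)
... | inj₂ y∈A | no  y≢x  = x∈p∪q⁺ (inj₂ (x∈p∧x≢y⇒x∈p-y y∈A y≢x))

∣p─⁅x⁆─q∣<∣p─q∣ : ∀ {n} {p q : Subset n} {x} → x ∈ p → x ∉ q → ∣ (p ─ ⁅ x ⁆) ─ q ∣ ℕ.< ∣ p ─ q ∣
∣p─⁅x⁆─q∣<∣p─q∣ {p = p} {q} {x} x∈p x∉q = subst (λ Z → ∣ Z ∣ ℕ.< ∣ p ─ q ∣) (p─q─r≡p─r─q p q ⁅ x ⁆)
  (x∈p⇒∣p-x∣<∣p∣ (x∈p∧x∉q⇒x∈p─q x∈p x∉q))

module Extension {n} {𝒟 : Family n} (L : AccessibleDistributiveLattice 𝒟)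
  {ρ : Subset n → ℕ} (U : IsUMatroid 𝒟 ρ) where
  open AccessibleDistributiveLattice L
  open IsUMatroid U

  ρ-∪-≤-step : ∀ {A C x} → A ∈𝒟 𝒟 → C ∈𝒟 𝒟 → x ∈ A → (A ─ ⁅ x ⁆) ∈𝒟 𝒟 →
    ρ (C ∪ (A ─ ⁅ x ⁆)) ℕ.≤ ρ C ℕ.+ ∣ (A ─ ⁅ x ⁆) ─ C ∣ → ρ (C ∪ A) ℕ.≤ ρ C ℕ.+ ∣ A ─ C ∣
  ρ-∪-≤-step {A} {C} {x} A∈𝒟 C∈𝒟 x∈A A′∈𝒟 IH with x ∈? C
  ... | yes x∈C = begin
    ρ (C ∪ A)              ≤⟨ monotone _ _ C∪A∈𝒟 C∪A′∈𝒟 (p∪q⊆p∪[q─⁅x⁆] C A x∈C) ⟩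
    ρ (C ∪ A′)             ≤⟨ IH ⟩
    ρ C ℕ.+ ∣ A′ ─ C ∣     ≤⟨ ℕP.+-monoʳ-≤ (ρ C) (p⊆q⇒∣p∣≤∣q∣ (─-monoˡ-⊆ C (p─q⊆p A ⁅ x ⁆))) ⟩
    ρ C ℕ.+ ∣ A ─ C ∣      ∎
    where
    open ℕP.≤-Reasoning
    A′ = A ─ ⁅ x ⁆
    C∪A∈𝒟 = ∪-closed C A C∈𝒟 A∈𝒟
    C∪A′∈𝒟 = ∪-closed C A′ C∈𝒟 A′∈𝒟
  ... | no x∉C = begin
    ρ (C ∪ A)              ≡⟨ cong ρ C∪A′∪⁅x⁆≡C∪A ⟨
    ρ ((C ∪ A′) ∪ ⁅ x ⁆)   ≤⟨ unit-increase (C ∪ A′) x C∪A′∈𝒟 C∪A′∪⁅x⁆∈𝒟 ⟩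
    suc (ρ (C ∪ A′))       ≤⟨ ℕ.s≤s IH ⟩
    suc (ρ C ℕ.+ ∣ A′ ─ C ∣) ≡⟨ ℕP.+-suc (ρ C) _ ⟨
    ρ C ℕ.+ suc ∣ A′ ─ C ∣ ≤⟨ ℕP.+-monoʳ-≤ (ρ C) (∣p─⁅x⁆─q∣<∣p─q∣ x∈A x∉C) ⟩
    ρ C ℕ.+ ∣ A ─ C ∣      ∎
    where
    open ℕP.≤-Reasoning
    A′ = A ─ ⁅ x ⁆
    C∪A′∪⁅x⁆≡C∪A = p∪[q─⁅x⁆]∪⁅x⁆≡p∪q C A x∈A
    C∪A′∈𝒟 = ∪-closed C A′ C∈𝒟 A′∈𝒟
    C∪A′∪⁅x⁆∈𝒟 = subst (_∈𝒟 𝒟) (sym C∪A′∪⁅x⁆≡C∪A) (∪-closed C A C∈𝒟 A∈𝒟)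

  ρ-∪-≤ : ∀ {A C} → A ∈𝒟 𝒟 → C ∈𝒟 𝒟 → ρ (C ∪ A) ℕ.≤ ρ C ℕ.+ ∣ A ─ C ∣
  ρ-∪-≤ {A} {C} A∈𝒟 C∈𝒟 = go A∈𝒟 (<-wellFounded ∣ A ∣)
    where
    go : ∀ {A} → A ∈𝒟 𝒟 → Acc ℕ._<_ ∣ A ∣ → ρ (C ∪ A) ℕ.≤ ρ C ℕ.+ ∣ A ─ C ∣
    go {A} A∈𝒟 (acc smaller) with ≡-dec Bool._≟_ A Sub.⊥
    ... | yes refl =
      subst (λ Z → ρ Z ℕ.≤ ρ C ℕ.+ ∣ Sub.⊥ ─ C ∣) (sym (∪-identityʳ C)) (ℕP.m≤m+n (ρ C) _)
    ... | no  A≢⊥  =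
      let (x , x∈A , A∖x∈𝒟) = accessible A A∈𝒟 A≢⊥
          A─x∈𝒟 = subst (_∈𝒟 𝒟) (∖⁅⁆≡─⁅⁆ A x) A∖x∈𝒟
      in ρ-∪-≤-step A∈𝒟 C∈𝒟 x∈A A─x∈𝒟 (go A─x∈𝒟 (smaller (x∈p⇒∣p-x∣<∣p∣ x∈A)))

  cost : Subset n → Subset n → ℕ
  cost X B = ρ B ℕ.+ ∣ X ─ B ∣

  members : List (Subset n)
  members = filter (λ B → 𝒟 B Bool.≟ true) (subsets n)

  nearestMember : Subset n → Subset n
  nearestMember X = argmin (cost X) Sub.⊥ members

  extension : Subset n → ℕ
  extension X = cost X (nearestMember X)

  nearestMember-∈𝒟 : ∀ X → nearestMember X ∈𝒟 𝒟
  nearestMember-∈𝒟 X = argmin-all (cost X) has-∅ (all-filter (λ B → 𝒟 B Bool.≟ true) (subsets n))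

  extension-≤ : ∀ X {B} → B ∈𝒟 𝒟 → extension X ℕ.≤ cost X B
  extension-≤ X {B} B∈𝒟 = f[argmin]≤v⁺ Sub.⊥ members
    (inj₂ (lose (∈-filter⁺ (λ B → 𝒟 B Bool.≟ true) (∈-subsets B) B∈𝒟) ℕP.≤-refl))

  extension-agrees : ∀ {A} → A ∈𝒟 𝒟 → extension A ≡ ρ A
  extension-agrees {A} A∈𝒟 = ℕP.≤-antisym
    (ℕP.≤-trans (extension-≤ A A∈𝒟) (ℕP.≤-reflexive cost-self))
    (ℕP.≤-trans (monotone A (B ∪ A) A∈𝒟 (∪-closed B A B∈𝒟 A∈𝒟) (q⊆p∪q B A)) (ρ-∪-≤ A∈𝒟 B∈𝒟))
    where
    B = nearestMember A
    B∈𝒟 = nearestMember-∈𝒟 A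
    cost-self : cost A A ≡ ρ A
    cost-self = trans (cong (λ Z → ρ A ℕ.+ ∣ Z ∣) (p─p≡⊥ A))
      (trans (cong (ρ A ℕ.+_) (∣⊥∣≡0 n)) (ℕP.+-identityʳ (ρ A)))

  extension-isMatroid : IsMatroid extension
  extension-isMatroid = record
    { ρ-∅ = trans (extension-agrees has-∅) ρ-∅
    ; monotone = λ X Y _ _ → monotone′ X Y
    ; submodular = λ X Y _ _ → submodular′ X Y
    ; unit-increase = λ X e _ _ → unit-increase′ X e
    }
    where
    monotone′ : ∀ X Y → X ⊆ Y → extension X ℕ.≤ extension Y
    monotone′ X Y X⊆Y = ℕP.≤-trans (extension-≤ X (nearestMember-∈𝒟 Y))
      (ℕP.+-monoʳ-≤ (ρ B) (p⊆q⇒∣p∣≤∣q∣ (─-monoˡ-⊆ B X⊆Y)))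
      where B = nearestMember Y
    unit-increase′ : ∀ X e → extension (X ∪ ⁅ e ⁆) ℕ.≤ suc (extension X)
    unit-increase′ X e = ℕP.≤-trans (extension-≤ (X ∪ ⁅ e ⁆) (nearestMember-∈𝒟 X))
      (ℕP.≤-trans (ℕP.+-monoʳ-≤ (ρ B) (∣p∪⁅x⁆─q∣≤1+∣p─q∣ X B e))
                  (ℕP.≤-reflexive (ℕP.+-suc (ρ B) _)))
      where B = nearestMember X
    submodular′ : ∀ X Y → extension (X ∪ Y) ℕ.+ extension (X ∩ Y) ℕ.≤ extension X ℕ.+ extension Y
    submodular′ X Y = begin
      extension (X ∪ Y) ℕ.+ extension (X ∩ Y)
        ≤⟨ ℕP.+-mono-≤ (extension-≤ (X ∪ Y) (∪-closed B C B∈𝒟 C∈𝒟))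
                       (extension-≤ (X ∩ Y) (∩-closed B C B∈𝒟 C∈𝒟)) ⟩
      cost (X ∪ Y) (B ∪ C) ℕ.+ cost (X ∩ Y) (B ∩ C)
        ≡⟨ ℕ+.interchange (ρ (B ∪ C)) _ _ _ ⟩
      (ρ (B ∪ C) ℕ.+ ρ (B ∩ C)) ℕ.+ (∣ (X ∪ Y) ─ (B ∪ C) ∣ ℕ.+ ∣ (X ∩ Y) ─ (B ∩ C) ∣)
        ≤⟨ ℕP.+-mono-≤ (submodular B C B∈𝒟 C∈𝒟) (∣─∣-submodular X Y B C) ⟩
      (ρ B ℕ.+ ρ C) ℕ.+ (∣ X ─ B ∣ ℕ.+ ∣ Y ─ C ∣)
        ≡⟨ ℕ+.interchange (ρ B) _ _ _ ⟩
      extension X ℕ.+ extension Y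
        ∎
      where
      open ℕP.≤-Reasoning
      B = nearestMember X
      C = nearestMember Y
      B∈𝒟 = nearestMember-∈𝒟 X
      C∈𝒟 = nearestMember-∈𝒟 Y

matroid-submodular : ∀ {n} {r : Subset n → ℕ} → IsMatroid r → Submodular r
matroid-submodular M A B = IsUMatroid.submodular M A B refl refl

matroid⇒UMatroid : ∀ {n} {𝒟 : Family n} {r} → IsMatroid r → IsUMatroid 𝒟 r
matroid⇒UMatroid M = record
  { ρ-∅ = ρ-∅
  ; monotone = λ A B _ _ → monotone A B refl refl
  ; submodular = λ A B _ _ → submodular A B refl refl
  ; unit-increase = λ A e _ _ → unit-increase A e refl refl
  }
  where open IsUMatroid M

≐-trans : ∀ {n} {P Q R : Pt n → Set} → P ≐ Q → Q ≐ R → P ≐ R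
≐-trans P≐Q Q≐R x = proj₁ (Q≐R x) ∘ proj₁ (P≐Q x) , proj₂ (P≐Q x) ∘ proj₂ (Q≐R x)

InBase-≐ : ∀ {n} {𝒟 : Family n} {ρ ρ′} → Sub.⊤ ∈𝒟 𝒟 → (∀ {A} → A ∈𝒟 𝒟 → ρ A ≡ ρ′ A) →
  InBase 𝒟 ρ ≐ InBase 𝒟 ρ′
InBase-≐ {𝒟 = 𝒟} ⊤∈𝒟 ρ≡ρ′ x = transport ρ≡ρ′ , transport (sym ∘ ρ≡ρ′)
  where
  transport : ∀ {σ τ} → (∀ {A} → A ∈𝒟 𝒟 → σ A ≡ τ A) → InBase 𝒟 σ x → InBase 𝒟 τ x
  transport σ≡τ (x-≤ , x-⊤) =
    (λ A A∈𝒟 → subst (λ k → sumOver A x ≤ ℕtoℚ k) (σ≡τ A∈𝒟) (x-≤ A A∈𝒟)) ,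
    trans x-⊤ (cong ℕtoℚ (σ≡τ ⊤∈𝒟))

corollary4p15 : (n : ℕ) (𝒟 : Family n) → AccessibleDistributiveLattice 𝒟 →
    ((ρ : Subset n → ℕ) → IsUMatroid 𝒟 ρ →
    Σ (Subset n → ℕ) λ r → IsMatroid r × (InBase 𝒟 ρ ≐ InBasePlusRec 𝒟 r)) ×
    ((r : Subset n → ℕ) → IsMatroid r →
    Σ (Subset n → ℕ) λ ρ → IsUMatroid 𝒟 ρ × (InBase 𝒟 ρ ≐ InBasePlusRec 𝒟 r))
corollary4p15 n 𝒟 L = fromUMatroid , fromMatroid
  where
  open AccessibleDistributiveLattice L using (has-E)
  fromUMatroid : (ρ : Subset n → ℕ) → IsUMatroid 𝒟 ρ →
    Σ (Subset n → ℕ) λ r → IsMatroid r × (InBase 𝒟 ρ ≐ InBasePlusRec 𝒟 r)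
  fromUMatroid ρ U = extension , extension-isMatroid ,
    ≐-trans (InBase-≐ has-E (sym ∘ extension-agrees))
            (base≐base+rec L {r = extension} (matroid-submodular extension-isMatroid))
    where open Extension L U
  fromMatroid : (r : Subset n → ℕ) → IsMatroid r →
    Σ (Subset n → ℕ) λ ρ → IsUMatroid 𝒟 ρ × (InBase 𝒟 ρ ≐ InBasePlusRec 𝒟 r)
  fromMatroid r M = r , matroid⇒UMatroid M , base≐base+rec L {r = r} (matroid-submodular M)
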